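{- $\mathcal{Z}_q=\left\langle \zeta_q^{\mathrm{TBZ}}(k_1,\dots,k_r)\,\middle|\, r\ge0,\ k_1,\dots,k_r\in\overline{\mathbb{N}},\ k_1\ne1\right\rangle_{\mathbb{Q}}$. In particular, this span is closed under the operator $q\frac{d}{dq}$.
   Context: $q$ is a formal variable. For $r\ge 0$, integers $k_1,\dots,k_r\ge 0$ and polynomials $Q_1\in X\mathbb{Q}[X]$, $Q_2,\dots,Q_r\in\mathbb{Q}[X]$ with $\deg(Q_j)\le k_j$, set $\zeta_q(k_1,\dots,k_r;Q_1,\dots,Q_r):=\sum_{m_1>\dots>m_r>0}\prod_{j=1}^r\frac{Q_j(q^{m_j})}{(1-q^{m_j})^{k_j}}\in\mathbb{Q}[[q]]$ (empty value $1$); $\mathcal{Z}_q$ is the $\mathbb{Q}$-span of all these series. Let $\overline{\mathbb{N}}:=\{\overline{1}\}\cup\mathbb{N}=\{\overline1,1,2,3,\dots\}$, where $\overline1$ is a formal symbol. For $k_1,\dots,k_r\in\overline{\mathbb{N}}$ with $k_1\neq1$, $\zeta_q^{\mathrm{TBZ}}(k_1,\dots,k_r):=\sum_{m_1>\dots>m_r>0}f(k_1,m_1)\cdots f(k_r,m_r)$, where $f(\overline1,m)=\frac{q^m}{1-q^m}$ and $f(k,m)=\frac{q^{(k-1)m}}{(1-q^m)^k}$ for $k\in\mathbb{N}$; $\zeta_q^{\mathrm{TBZ}}(\emptyset)=1$. -}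

module Defs where

open import Data.Nat as ℕ using (ℕ; zero; suc; _∸_; _≤_)
open import Data.Nat.Divisibility using (_∣?_)
open import Data.Nat.DivMod using (_/_)
open import Data.Integer using (+_)
open import Data.Rational as ℚ using (ℚ; 0ℚ; 1ℚ)
open import Data.List using (List; []; _∷_; length; map; replicate; _++_)
open import Data.List.Relation.Unary.All using (All)
open import Data.Product using (Σ; _×_; _,_; proj₁; proj₂; ∃)
open import Data.Unit using (⊤)
open import Relation.Nullary using (¬_; yes; no)
open import Relation.Binary.PropositionalEquality using (_≡_)

Series : Set
Series = ℕ → ℚ

ℕ→ℚ : ℕ → ℚ
ℕ→ℚ n = + n ℚ./ 1

sumTo : ℕ → (ℕ → ℚ) → ℚ
sumTo zero    f = 0ℚ
sumTo (suc n) f = sumTo n f ℚ.+ f n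

sumSer : ℕ → (ℕ → Series) → Series
sumSer n F N = sumTo n (λ i → F i N)

oneS : Series
oneS zero    = 1ℚ
oneS (suc _) = 0ℚ

_*S_ : Series → Series → Series
(f *S g) n = sumTo (suc n) (λ i → f i ℚ.* g (n ∸ i))

-- polynomial given by coefficient list (constant term first), as a series
polyS : List ℚ → Series
polyS []       n       = 0ℚ
polyS (a ∷ as) zero    = a
polyS (a ∷ as) (suc n) = polyS as n

-- 1/(1-y)^k as a power series in y
geomS : Series
geomS _ = 1ℚ

invPowS : ℕ → Series
invPowS zero    = oneS
invPowS (suc k) = geomS *S invPowS k

-- substitution y ↦ q^(suc m') (i.e. y = q^m with m = suc m' ≥ 1)
substS : ℕ → Series → Series
substS m' F N with suc m' ∣? N
... | yes _ = F (N / suc m')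
... | no  _ = 0ℚ

-- Q(q^m)/(1-q^m)^k as a power series in q, for m = suc m'
termS : ℕ → List ℚ → ℕ → Series
termS k Q m' = substS m' (polyS Q *S invPowS k)

Entry : Set
Entry = ℕ × List ℚ

-- G es m = Σ_{m > m_2 > ... > m_r > 0} Π_j Q_j(q^{m_j})/(1-q^{m_j})^{k_j}  (a finite sum)
G : List Entry → ℕ → Series
G []             m = oneS
G ((k , Q) ∷ es) m = sumSer (m ∸ 1) (λ i → termS k Q i *S G es (suc i))

-- The outer sum over m_1 ≥ 1 is infinite; its
-- coefficient of q^N only receives contributions from m_1 ≤ N because
-- Q_1 ∈ XQ[X] (resp. k_1 ≠ 1 for TBZ) makes the m_1-th summand O(q^{m_1}).
ζq : List Entry → Series
ζq []             = oneS
ζq ((k , Q) ∷ es) N = sumTo N (λ i → (termS k Q i *S G es (suc i)) N)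

-- admissibility: deg(Q_j) ≤ k_j and Q_1 ∈ XQ[X]
degOK : Entry → Set
degOK (k , Q) = length Q ≤ suc k

noConst : List ℚ → Set
noConst []      = ⊤
noConst (a ∷ _) = a ≡ 0ℚ

firstOK : List Entry → Set
firstOK []             = ⊤
firstOK ((k , Q) ∷ _) = noConst Q

ValidZ : List Entry → Set
ValidZ L = All degOK L × firstOK L

IndexZ : Set
IndexZ = Σ (List Entry) ValidZ

genZ : IndexZ → Series
genZ (L , _) = ζq L

-- \overline{ℕ} = {1̄, 1, 2, 3, ...};  nat n  stands for the positive integer n+1
data N̄ : Set where
  bar1 : N̄
  nat  : ℕ → N̄

-- f(1̄,m) = q^m/(1-q^m) ;  f(k,m) = q^{(k-1)m}/(1-q^m)^k
toEntry : N̄ → Entry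
toEntry bar1    = (1 , 0ℚ ∷ 1ℚ ∷ [])
toEntry (nat n) = (suc n , replicate n 0ℚ ++ (1ℚ ∷ []))

ζTBZ : List N̄ → Series
ζTBZ ks = ζq (map toEntry ks)

firstNot1 : List N̄ → Set
firstNot1 []      = ⊤
firstNot1 (k ∷ _) = ¬ (k ≡ nat 0)

IndexTBZ : Set
IndexTBZ = Σ (List N̄) firstNot1

genTBZ : IndexTBZ → Series
genTBZ (ks , _) = ζTBZ ks

lincomb : {I : Set} → (I → Series) → List (ℚ × I) → Series
lincomb gen []             N = 0ℚ
lincomb gen ((c , i) ∷ cs) N = c ℚ.* gen i N ℚ.+ lincomb gen cs N

InSpan : {I : Set} → (I → Series) → Series → Set
InSpan {I} gen f = ∃ λ (cs : List (ℚ × I)) → ∀ N → f N ≡ lincomb gen cs N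

qddq : Series → Series
qddq f n = ℕ→ℚ n ℚ.* f n

-- Let G(m) = Σ_{m > m₁ > ⋯ > m_r > 0} Π_j E_j(q^{m_j}) with entries E_j(y) = Q_j(y)/(1 − y)^{k_j};
-- ζ_q is the diagonal of G, as only m₁ ≤ N contributes to the coefficient of q^N, and G is
-- multilinear in the entries.  Each entry is a combination of y^a/(1 − y)^k with 0 ≤ a ≤ k
-- (1 ≤ a in the first position), and the relation
--   y^a/(1 − y)^{k+1} = y^a/(1 − y)^k + y^{a+1}/(1 − y)^{k+1}
-- expresses all of these through the TBZ entries y/(1 − y) and y^{k−1}/(1 − y)^k, the first
-- position never needing 1/(1 − y).  For q d/dq, Leibniz distributes the weight N over the
-- entries: E(q^{m₁}) contributes m₁ (y E′)(q^{m₁}), with y E′ again of the first-position kind,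
-- and the weight m₁ − 1 left on the tail G(m₁) is absorbed by writing m − 1 = 1 + (m − 1 − m₁)
-- + (m₁ − 1) inside G(m): the middle part counts the ways to insert one more entry
-- 1 = 1/(1 − y) − y/(1 − y) in front, the last passes the weight on to the tail.

module Submission where

open import Defs
open import Data.Product using (_×_; Σ; _,_; proj₁; proj₂)
open import Function.Base using (_∘_)
open import Function.Bundles using (_⇔_; mk⇔)

open import Data.Nat as ℕ using (ℕ; zero; suc; _∸_; _≤_; z≤n; s≤s)
import Data.Nat.Properties as ℕP
import Data.List.Properties as ListP
open import Data.Nat.Divisibility using (_∣?_; ∣⇒≤)
open import Data.Nat.DivMod using (_/_; m/n*n≡m; m≥n⇒m/n>0)
import Data.Integer as ℤ
import Data.Integer.Properties as ℤP
open import Data.Rational using (ℚ; 0ℚ; 1ℚ; _+_; _*_; -_; toℚᵘ)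
import Data.Rational.Properties as ℚP
import Data.Rational.Unnormalised as ℚᵘ
import Data.Rational.Unnormalised.Properties as ℚᵘP
open import Data.Rational.Solver using (module +-*-Solver)
open import Data.List using (List; []; _∷_; length; map; replicate; _++_)
open import Data.List.Relation.Unary.All using (All; []; _∷_; universal)
open import Data.List.Relation.Unary.All.Properties using (map⁺)
open import Data.Unit using (tt)
open import Relation.Nullary using (¬_; yes; no; contradiction)
open import Relation.Binary.PropositionalEquality
  using (_≡_; refl; cong; cong₂; trans; sym; module ≡-Reasoning)
open ≡-Reasoning
open +-*-Solver

ℕ→ℚ-suc : ∀ n → ℕ→ℚ (suc n) ≡ 1ℚ + ℕ→ℚ n
ℕ→ℚ-suc n = ℚP.toℚᵘ-injective (beginᵘ
  toℚᵘ (ℕ→ℚ (suc n))                      ≈⟨ ℚP.toℚᵘ-fromℚᵘ (ℚᵘ.mkℚᵘ (ℤ.+ suc n) 0) ⟩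
  ℚᵘ.mkℚᵘ (ℤ.+ suc n) 0                   ≈⟨ ℚᵘ.*≡* cross-multiplied ⟩
  toℚᵘ 1ℚ ℚᵘ.+ ℚᵘ.mkℚᵘ (ℤ.+ n) 0          ≈⟨ ℚᵘP.+-congʳ (toℚᵘ 1ℚ) (ℚP.toℚᵘ-fromℚᵘ (ℚᵘ.mkℚᵘ (ℤ.+ n) 0)) ⟨
  toℚᵘ 1ℚ ℚᵘ.+ toℚᵘ (ℕ→ℚ n)               ≈⟨ ℚP.toℚᵘ-homo-+ 1ℚ (ℕ→ℚ n) ⟨
  toℚᵘ (1ℚ + ℕ→ℚ n)                       ∎ᵘ)
  where
  open ℚᵘP.≃-Reasoning renaming (begin_ to beginᵘ_; _∎ to _∎ᵘ)
  cross-multiplied : ℤ.+ suc n ℤ.* (ℤ.1ℤ ℤ.* ℤ.1ℤ) ≡ (ℤ.1ℤ ℤ.* ℤ.1ℤ ℤ.+ ℤ.+ n ℤ.* ℤ.1ℤ) ℤ.* ℤ.1ℤ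
  cross-multiplied = trans (ℤP.*-identityʳ _)
    (sym (trans (ℤP.*-identityʳ _) (cong (λ x → ℤ.1ℤ ℤ.+ x) (ℤP.*-identityʳ (ℤ.+ n)))))

ℕ→ℚ-+ : ∀ m n → ℕ→ℚ (m ℕ.+ n) ≡ ℕ→ℚ m + ℕ→ℚ n
ℕ→ℚ-+ zero    n = sym (ℚP.+-identityˡ _)
ℕ→ℚ-+ (suc m) n = begin
  ℕ→ℚ (suc (m ℕ.+ n))    ≡⟨ ℕ→ℚ-suc (m ℕ.+ n) ⟩
  1ℚ + ℕ→ℚ (m ℕ.+ n)     ≡⟨ cong (1ℚ +_) (ℕ→ℚ-+ m n) ⟩
  1ℚ + (ℕ→ℚ m + ℕ→ℚ n)   ≡⟨ ℚP.+-assoc 1ℚ (ℕ→ℚ m) (ℕ→ℚ n) ⟨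
  1ℚ + ℕ→ℚ m + ℕ→ℚ n     ≡⟨ cong (_+ ℕ→ℚ n) (ℕ→ℚ-suc m) ⟨
  ℕ→ℚ (suc m) + ℕ→ℚ n    ∎

ℕ→ℚ-* : ∀ m n → ℕ→ℚ (m ℕ.* n) ≡ ℕ→ℚ m * ℕ→ℚ n
ℕ→ℚ-* zero    n = sym (ℚP.*-zeroˡ (ℕ→ℚ n))
ℕ→ℚ-* (suc m) n = begin
  ℕ→ℚ (n ℕ.+ m ℕ.* n)        ≡⟨ ℕ→ℚ-+ n (m ℕ.* n) ⟩
  ℕ→ℚ n + ℕ→ℚ (m ℕ.* n)      ≡⟨ cong (ℕ→ℚ n +_) (ℕ→ℚ-* m n) ⟩
  ℕ→ℚ n + ℕ→ℚ m * ℕ→ℚ n      ≡⟨ solve 2 (λ a b → b :+ a :* b := (con 1ℚ :+ a) :* b) refl (ℕ→ℚ m) (ℕ→ℚ n) ⟩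
  (1ℚ + ℕ→ℚ m) * ℕ→ℚ n       ≡⟨ cong (_* ℕ→ℚ n) (ℕ→ℚ-suc m) ⟨
  ℕ→ℚ (suc m) * ℕ→ℚ n        ∎

-- Linear spans of ℚ-valued functions

infix  4 _≐_
infixl 6 _⊕_
infixl 7 _⊙_

_≐_ : {A : Set} → (A → ℚ) → (A → ℚ) → Set
f ≐ g = ∀ a → f a ≡ g a

_⊕_ : {A : Set} → (A → ℚ) → (A → ℚ) → A → ℚ
(f ⊕ g) a = f a + g a

_⊙_ : {A : Set} → ℚ → (A → ℚ) → A → ℚ
(c ⊙ f) a = c * f a

𝟘 : {A : Set} → A → ℚ
𝟘 _ = 0ℚ

scaleBy : {A : Set} → (A → ℚ) → (A → ℚ) → A → ℚ
scaleBy w f a = w a * f a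

≐-refl : {A : Set} {f : A → ℚ} → f ≐ f
≐-refl _ = refl

≐-sym : {A : Set} {f g : A → ℚ} → f ≐ g → g ≐ f
≐-sym p a = sym (p a)

≐-trans : {A : Set} {f g h : A → ℚ} → f ≐ g → g ≐ h → f ≐ h
≐-trans p q a = trans (p a) (q a)

linComb : {I A : Set} → (I → A → ℚ) → List (ℚ × I) → A → ℚ
linComb gen []             a = 0ℚ
linComb gen ((c , i) ∷ cs) a = c * gen i a + linComb gen cs a

Span : {I A : Set} → (I → A → ℚ) → (A → ℚ) → Set
Span {I} gen f = Σ (List (ℚ × I)) λ cs → f ≐ linComb gen cs

module _ {I A : Set} {gen : I → A → ℚ} where

  span-≐ : {f g : A → ℚ} → f ≐ g → Span gen g → Span gen f
  span-≐ p (cs , q) = cs , ≐-trans p q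

  span-𝟘 : Span gen 𝟘
  span-𝟘 = [] , ≐-refl

  span-gen : (i : I) → Span gen (gen i)
  span-gen i = (1ℚ , i) ∷ [] , λ a → sym (trans (ℚP.+-identityʳ _) (ℚP.*-identityˡ _))

  span-⊕ : {f g : A → ℚ} → Span gen f → Span gen g → Span gen (f ⊕ g)
  span-⊕ (cs , p) (ds , q) = cs ++ ds , λ a → trans (cong₂ _+_ (p a) (q a)) (sym (linComb-++ cs a))
    where
    linComb-++ : ∀ cs → linComb gen (cs ++ ds) ≐ linComb gen cs ⊕ linComb gen ds
    linComb-++ []             a = sym (ℚP.+-identityˡ _)
    linComb-++ ((c , i) ∷ cs) a = trans (cong (c * gen i a +_) (linComb-++ cs a))
      (sym (ℚP.+-assoc (c * gen i a) (linComb gen cs a) (linComb gen ds a)))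

  span-⊙ : (c : ℚ) {f : A → ℚ} → Span gen f → Span gen (c ⊙ f)
  span-⊙ c (cs , p) = map scale cs , λ a → trans (cong (c *_) (p a)) (sym (linComb-scale cs a))
    where
    scale : ℚ × I → ℚ × I
    scale (d , i) = c * d , i
    linComb-scale : ∀ cs → linComb gen (map scale cs) ≐ c ⊙ linComb gen cs
    linComb-scale []             a = sym (ℚP.*-zeroʳ c)
    linComb-scale ((d , i) ∷ cs) a = trans (cong (c * d * gen i a +_) (linComb-scale cs a))
      (solve 4 (λ c d g r → c :* d :* g :+ c :* r := c :* (d :* g :+ r)) refl c d (gen i a) (linComb gen cs a))

  span-⊕-cancelˡ : {f g h : A → ℚ} → f ≐ g ⊕ h → Span gen f → Span gen g → Span gen h
  span-⊕-cancelˡ {f} {g} {h} p sf sg = span-≐ h≐f-g (span-⊕ sf (span-⊙ (- 1ℚ) sg))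
    where
    h≐f-g : h ≐ f ⊕ (- 1ℚ) ⊙ g
    h≐f-g a = trans (solve 2 (λ g h → h := (g :+ h) :+ (:- con 1ℚ) :* g) refl (g a) (h a))
                    (cong (_+ (- 1ℚ) * g a) (sym (p a)))

  span-⊕-cancelʳ : {f g h : A → ℚ} → f ≐ g ⊕ h → Span gen f → Span gen h → Span gen g
  span-⊕-cancelʳ {g = g} {h} p = span-⊕-cancelˡ (λ a → trans (p a) (ℚP.+-comm (g a) (h a)))

  span-trans : {J : Set} {gen′ : J → A → ℚ} {f : A → ℚ} →
               (∀ j → Span gen (gen′ j)) → Span gen′ f → Span gen f
  span-trans {gen′ = gen′} spans (cs , p) = span-≐ p (span-linComb cs)
    where
    span-linComb : ∀ cs → Span gen (linComb gen′ cs)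
    span-linComb []             = span-𝟘
    span-linComb ((c , j) ∷ cs) = span-⊕ (span-⊙ c (spans j)) (span-linComb cs)

  span-reindex : {J : Set} {gen′ : J → A → ℚ} {f : A → ℚ} (φ : J → I) →
                 (∀ j → gen′ j ≐ gen (φ j)) → Span gen′ f → Span gen f
  span-reindex φ p = span-trans (λ j → span-≐ (p j) (span-gen (φ j)))

record IsLinear {A B : Set} (Φ : (A → ℚ) → B → ℚ) : Set where
  field
    resp-≐ : ∀ {f g} → f ≐ g → Φ f ≐ Φ g
    ⊕-homo : ∀ f g → Φ (f ⊕ g) ≐ Φ f ⊕ Φ g
    ⊙-homo : ∀ c f → Φ (c ⊙ f) ≐ c ⊙ Φ f

  𝟘-homo : Φ 𝟘 ≐ 𝟘
  𝟘-homo b = begin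
    Φ 𝟘 b             ≡⟨ resp-≐ (λ _ → sym (ℚP.*-zeroˡ 0ℚ)) b ⟩
    Φ (0ℚ ⊙ 𝟘) b      ≡⟨ ⊙-homo 0ℚ 𝟘 b ⟩
    0ℚ * Φ 𝟘 b        ≡⟨ ℚP.*-zeroˡ (Φ 𝟘 b) ⟩
    0ℚ                ∎

  linComb-homo : {I : Set} (gen : I → A → ℚ) → ∀ cs → Φ (linComb gen cs) ≐ linComb (λ i → Φ (gen i)) cs
  linComb-homo gen []             = 𝟘-homo
  linComb-homo gen ((c , i) ∷ cs) b = begin
    Φ (c ⊙ gen i ⊕ linComb gen cs) b              ≡⟨ ⊕-homo (c ⊙ gen i) (linComb gen cs) b ⟩
    Φ (c ⊙ gen i) b + Φ (linComb gen cs) b        ≡⟨ cong₂ _+_ (⊙-homo c (gen i) b) (linComb-homo gen cs b) ⟩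
    c * Φ (gen i) b + linComb (λ i → Φ (gen i)) cs b ∎

  span-map : {I : Set} {gen : I → A → ℚ} {f : A → ℚ} → Span gen f → Span (λ i → Φ (gen i)) (Φ f)
  span-map {gen = gen} (cs , p) = cs , ≐-trans (resp-≐ p) (linComb-homo gen cs)

open IsLinear using (span-map)

∘-linear : {A B C : Set} {Φ : (B → ℚ) → C → ℚ} {Ψ : (A → ℚ) → B → ℚ} →
           IsLinear Φ → IsLinear Ψ → IsLinear (λ f → Φ (Ψ f))
∘-linear {Ψ = Ψ} LΦ LΨ = record
  { resp-≐ = λ p → LΦ.resp-≐ (LΨ.resp-≐ p)
  ; ⊕-homo = λ f g → ≐-trans (LΦ.resp-≐ (LΨ.⊕-homo f g)) (LΦ.⊕-homo (Ψ f) (Ψ g))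
  ; ⊙-homo = λ c f → ≐-trans (LΦ.resp-≐ (LΨ.⊙-homo c f)) (LΦ.⊙-homo c (Ψ f))
  }
  where
  module LΦ = IsLinear LΦ
  module LΨ = IsLinear LΨ

scaleBy-linear : {A : Set} (w : A → ℚ) → IsLinear (scaleBy w)
scaleBy-linear w = record
  { resp-≐ = λ p a → cong (w a *_) (p a)
  ; ⊕-homo = λ f g a → ℚP.*-distribˡ-+ (w a) (f a) (g a)
  ; ⊙-homo = λ c f a → solve 3 (λ w c x → w :* (c :* x) := c :* (w :* x)) refl (w a) c (f a)
  }

span-bilinear : {A B C I J : Set} (β : (A → ℚ) → (B → ℚ) → C → ℚ) →
                (∀ g → IsLinear (λ f → β f g)) → (∀ f → IsLinear (β f)) →
                {gen₁ : I → A → ℚ} {gen₂ : J → B → ℚ} {f : A → ℚ} {g : B → ℚ} →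
                Span gen₁ f → Span gen₂ g →
                Span (λ (ij : I × J) → β (gen₁ (proj₁ ij)) (gen₂ (proj₂ ij))) (β f g)
span-bilinear β linearˡ linearʳ {gen₁} {g = g} sf sg =
  span-trans (λ i → span-reindex (i ,_) (λ _ → ≐-refl) (span-map (linearʳ (gen₁ i)) sg))
             (span-map (linearˡ g) sf)

sumTo-cong : ∀ n {f g : ℕ → ℚ} → (∀ i → i ℕ.< n → f i ≡ g i) → sumTo n f ≡ sumTo n g
sumTo-cong zero    p = refl
sumTo-cong (suc n) p = cong₂ _+_ (sumTo-cong n (λ i i<n → p i (ℕP.m<n⇒m<1+n i<n))) (p n (ℕP.n<1+n n))

sumTo-≐ : ∀ n {f g : ℕ → ℚ} → f ≐ g → sumTo n f ≡ sumTo n g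
sumTo-≐ n p = sumTo-cong n (λ i _ → p i)

sumTo-⊕ : ∀ n (f g : ℕ → ℚ) → sumTo n (f ⊕ g) ≡ sumTo n f + sumTo n g
sumTo-⊕ zero    f g = sym (ℚP.+-identityˡ 0ℚ)
sumTo-⊕ (suc n) f g = trans (cong (_+ (f n + g n)) (sumTo-⊕ n f g))
  (solve 4 (λ a b c d → (a :+ b) :+ (c :+ d) := (a :+ c) :+ (b :+ d)) refl (sumTo n f) (sumTo n g) (f n) (g n))

sumTo-⊙ : ∀ n c (f : ℕ → ℚ) → sumTo n (c ⊙ f) ≡ c * sumTo n f
sumTo-⊙ zero    c f = sym (ℚP.*-zeroʳ c)
sumTo-⊙ (suc n) c f = trans (cong (_+ c * f n) (sumTo-⊙ n c f)) (sym (ℚP.*-distribˡ-+ c (sumTo n f) (f n)))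

sumTo-𝟘 : ∀ n → sumTo n 𝟘 ≡ 0ℚ
sumTo-𝟘 zero    = refl
sumTo-𝟘 (suc n) = trans (ℚP.+-identityʳ _) (sumTo-𝟘 n)

sumTo-unfoldˡ : ∀ n (f : ℕ → ℚ) → sumTo (suc n) f ≡ f 0 + sumTo n (λ i → f (suc i))
sumTo-unfoldˡ zero    f = trans (ℚP.+-identityˡ (f 0)) (sym (ℚP.+-identityʳ (f 0)))
sumTo-unfoldˡ (suc n) f = trans (cong (_+ f (suc n)) (sumTo-unfoldˡ n f))
  (ℚP.+-assoc (f 0) (sumTo n (λ i → f (suc i))) (f (suc n)))

sumTo-const : ∀ n c → sumTo n (λ _ → c) ≡ ℕ→ℚ n * c
sumTo-const zero    c = sym (ℚP.*-zeroˡ c)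
sumTo-const (suc n) c = begin
  sumTo n (λ _ → c) + c   ≡⟨ cong (_+ c) (sumTo-const n c) ⟩
  ℕ→ℚ n * c + c           ≡⟨ solve 2 (λ k c → k :* c :+ c := (con 1ℚ :+ k) :* c) refl (ℕ→ℚ n) c ⟩
  (1ℚ + ℕ→ℚ n) * c        ≡⟨ cong (_* c) (ℕ→ℚ-suc n) ⟨
  ℕ→ℚ (suc n) * c         ∎

-- Termwise, n = 1 + (n − 1 − i) + i for i < n.
ℕ→ℚ*sumTo : ∀ n (a : ℕ → ℚ) →
  ℕ→ℚ n * sumTo n a ≡ sumTo n a + sumTo n (λ j → sumTo j a) + sumTo n (λ i → ℕ→ℚ i * a i)
ℕ→ℚ*sumTo zero    a = refl
ℕ→ℚ*sumTo (suc n) a = begin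
  ℕ→ℚ (suc n) * (S + a n)
    ≡⟨ cong (_* (S + a n)) (ℕ→ℚ-suc n) ⟩
  (1ℚ + ℕ→ℚ n) * (S + a n)
    ≡⟨ solve 3 (λ k s x → (con 1ℚ :+ k) :* (s :+ x) := k :* s :+ s :+ (con 1ℚ :+ k) :* x)
               refl (ℕ→ℚ n) S (a n) ⟩
  ℕ→ℚ n * S + S + (1ℚ + ℕ→ℚ n) * a n
    ≡⟨ cong (λ x → x + S + (1ℚ + ℕ→ℚ n) * a n) (ℕ→ℚ*sumTo n a) ⟩
  S + T + U + S + (1ℚ + ℕ→ℚ n) * a n
    ≡⟨ solve 5 (λ s t u k x → s :+ t :+ u :+ s :+ (con 1ℚ :+ k) :* x
                              := (s :+ x) :+ (t :+ s) :+ (u :+ k :* x))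
               refl S T U (ℕ→ℚ n) (a n) ⟩
  (S + a n) + (T + S) + (U + ℕ→ℚ n * a n) ∎
  where
  S = sumTo n a
  T = sumTo n (λ j → sumTo j a)
  U = sumTo n (λ i → ℕ→ℚ i * a i)

sumTo-linear : {A B C : Set} (Φ : ℕ → (A → ℚ) → B → ℚ) → (∀ i → IsLinear (Φ i)) →
               (bound : C → ℕ) (at : C → B) →
               IsLinear (λ f c → sumTo (bound c) (λ i → Φ i f (at c)))
sumTo-linear Φ linear bound at = record
  { resp-≐ = λ p c → sumTo-≐ (bound c) (λ i → IsLinear.resp-≐ (linear i) p (at c))
  ; ⊕-homo = λ f g c → trans (sumTo-≐ (bound c) (λ i → IsLinear.⊕-homo (linear i) f g (at c)))
                             (sumTo-⊕ (bound c) (λ i → Φ i f (at c)) (λ i → Φ i g (at c)))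
  ; ⊙-homo = λ k f c → trans (sumTo-≐ (bound c) (λ i → IsLinear.⊙-homo (linear i) k f (at c)))
                             (sumTo-⊙ (bound c) k (λ i → Φ i f (at c)))
  }

*S-linearˡ : (g : Series) → IsLinear (_*S g)
*S-linearˡ g = record
  { resp-≐ = λ p n → sumTo-≐ (suc n) (λ i → cong (_* g (n ∸ i)) (p i))
  ; ⊕-homo = λ f f′ n → trans (sumTo-≐ (suc n) (λ i → ℚP.*-distribʳ-+ (g (n ∸ i)) (f i) (f′ i)))
                              (sumTo-⊕ (suc n) _ _)
  ; ⊙-homo = λ c f n → trans (sumTo-≐ (suc n) (λ i → ℚP.*-assoc c (f i) (g (n ∸ i)))) (sumTo-⊙ (suc n) c _)
  }

*S-linearʳ : (f : Series) → IsLinear (f *S_)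
*S-linearʳ f = record
  { resp-≐ = λ p n → sumTo-≐ (suc n) (λ i → cong (f i *_) (p (n ∸ i)))
  ; ⊕-homo = λ g g′ n → trans (sumTo-≐ (suc n) (λ i → ℚP.*-distribˡ-+ (f i) (g (n ∸ i)) (g′ (n ∸ i))))
                              (sumTo-⊕ (suc n) _ _)
  ; ⊙-homo = λ c g n → trans (sumTo-≐ (suc n) (λ i → solve 3 (λ a c b → a :* (c :* b) := c :* (a :* b))
                                                              refl (f i) c (g (n ∸ i))))
                             (sumTo-⊙ (suc n) c _)
  }

*S-identityˡ : (g : Series) → oneS *S g ≐ g
*S-identityˡ g n = begin
  sumTo (suc n) (λ i → oneS i * g (n ∸ i))            ≡⟨ sumTo-unfoldˡ n _ ⟩
  1ℚ * g n + sumTo n (λ i → 0ℚ * g (n ∸ suc i))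
    ≡⟨ cong₂ _+_ (ℚP.*-identityˡ (g n)) (trans (sumTo-≐ n (λ i → ℚP.*-zeroˡ (g (n ∸ suc i)))) (sumTo-𝟘 n)) ⟩
  g n + 0ℚ                                            ≡⟨ ℚP.+-identityʳ (g n) ⟩
  g n                                                 ∎

qddq-linear : IsLinear qddq
qddq-linear = scaleBy-linear ℕ→ℚ

qddq-*S : (f g : Series) → qddq (f *S g) ≐ qddq f *S g ⊕ f *S qddq g
qddq-*S f g n = begin
  ℕ→ℚ n * sumTo (suc n) (λ i → f i * g (n ∸ i))       ≡⟨ sumTo-⊙ (suc n) (ℕ→ℚ n) _ ⟨
  sumTo (suc n) (λ i → ℕ→ℚ n * (f i * g (n ∸ i)))     ≡⟨ sumTo-cong (suc n) split ⟩
  sumTo (suc n) ((λ i → ℕ→ℚ i * f i * g (n ∸ i)) ⊕ (λ i → f i * (ℕ→ℚ (n ∸ i) * g (n ∸ i))))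
                                                      ≡⟨ sumTo-⊕ (suc n) _ _ ⟩
  (qddq f *S g ⊕ f *S qddq g) n                       ∎
  where
  split : ∀ i → i ℕ.< suc n →
          ℕ→ℚ n * (f i * g (n ∸ i)) ≡ ℕ→ℚ i * f i * g (n ∸ i) + f i * (ℕ→ℚ (n ∸ i) * g (n ∸ i))
  split i (s≤s i≤n) = begin
    ℕ→ℚ n * (f i * g (n ∸ i))
      ≡⟨ cong (λ x → ℕ→ℚ x * (f i * g (n ∸ i))) (ℕP.m+[n∸m]≡n i≤n) ⟨
    ℕ→ℚ (i ℕ.+ (n ∸ i)) * (f i * g (n ∸ i))
      ≡⟨ cong (_* (f i * g (n ∸ i))) (ℕ→ℚ-+ i (n ∸ i)) ⟩
    (ℕ→ℚ i + ℕ→ℚ (n ∸ i)) * (f i * g (n ∸ i))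
      ≡⟨ solve 4 (λ a b x y → (a :+ b) :* (x :* y) := a :* x :* y :+ x :* (b :* y))
                 refl (ℕ→ℚ i) (ℕ→ℚ (n ∸ i)) (f i) (g (n ∸ i)) ⟩
    ℕ→ℚ i * f i * g (n ∸ i) + f i * (ℕ→ℚ (n ∸ i) * g (n ∸ i)) ∎

substS-linear : ∀ m → IsLinear (substS m)
substS-linear m = record { resp-≐ = resp ; ⊕-homo = add ; ⊙-homo = scale }
  where
  resp : ∀ {f g} → f ≐ g → substS m f ≐ substS m g
  resp p N with suc m ∣? N
  ... | yes _ = p (N / suc m)
  ... | no  _ = refl
  add : ∀ f g → substS m (f ⊕ g) ≐ substS m f ⊕ substS m g
  add f g N with suc m ∣? N
  ... | yes _ = refl
  ... | no  _ = sym (ℚP.+-identityˡ 0ℚ)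
  scale : ∀ c f → substS m (c ⊙ f) ≐ c ⊙ substS m f
  scale c f N with suc m ∣? N
  ... | yes _ = refl
  ... | no  _ = sym (ℚP.*-zeroʳ c)

substS-oneS : ∀ m → substS m oneS ≐ oneS
substS-oneS m zero with suc m ∣? zero
... | yes _ = refl
... | no  _ = refl
substS-oneS m (suc N) with suc m ∣? suc N
... | no  _ = refl
... | yes m∣N with suc N / suc m | m≥n⇒m/n>0 (∣⇒≤ m∣N)
...   | suc _ | _ = refl

qddq-substS : ∀ m (f : Series) → qddq (substS m f) ≐ ℕ→ℚ (suc m) ⊙ substS m (qddq f)
qddq-substS m f N with suc m ∣? N
... | no  _ = trans (ℚP.*-zeroʳ (ℕ→ℚ N)) (sym (ℚP.*-zeroʳ (ℕ→ℚ (suc m))))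
... | yes m∣N = begin
  ℕ→ℚ N * f d
    ≡⟨ cong (λ x → ℕ→ℚ x * f d) (m/n*n≡m m∣N) ⟨
  ℕ→ℚ (d ℕ.* suc m) * f d
    ≡⟨ cong (_* f d) (ℕ→ℚ-* d (suc m)) ⟩
  ℕ→ℚ d * ℕ→ℚ (suc m) * f d
    ≡⟨ solve 3 (λ a b c → a :* b :* c := b :* (a :* c)) refl (ℕ→ℚ d) (ℕ→ℚ (suc m)) (f d) ⟩
  ℕ→ℚ (suc m) * (ℕ→ℚ d * f d) ∎
  where d = N / suc m

-- Nested sums

Family : Set
Family = ℕ × ℕ → ℚ

slice : Family → ℕ → Series
slice F m n = F (m , n)

-- consFam E F (m , N) is the coefficient of q^N in Σ_{0 < m₁ < m} E(q^{m₁}) · F(m₁).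
consFam : Series → Family → Family
consFam E F (m , N) = sumTo (m ∸ 1) (λ i → (substS i E *S slice F (suc i)) N)

nestedSum : List Series → Family
nestedSum []       (m , N) = oneS N
nestedSum (E ∷ Es) = consFam E (nestedSum Es)

diagonal : Family → Series
diagonal F N = F (suc N , N)

consFam-linearˡ : (F : Family) → IsLinear (λ E → consFam E F)
consFam-linearˡ F = sumTo-linear (λ i E → substS i E *S slice F (suc i))
  (λ i → ∘-linear (*S-linearˡ (slice F (suc i))) (substS-linear i)) (λ (m , _) → m ∸ 1) proj₂

consFam-linearʳ : (E : Series) → IsLinear (consFam E)
consFam-linearʳ E = sumTo-linear (λ i F → substS i E *S slice F (suc i))
  (λ i → ∘-linear (*S-linearʳ (substS i E)) slice-linear) (λ (m , _) → m ∸ 1) proj₂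
  where
  slice-linear : ∀ {m} → IsLinear (λ F → slice F m)
  slice-linear {m} = record
    { resp-≐ = λ p n → p (m , n) ; ⊕-homo = λ _ _ _ → refl ; ⊙-homo = λ _ _ _ → refl }

diagonal-linear : IsLinear diagonal
diagonal-linear = record
  { resp-≐ = λ p N → p (suc N , N) ; ⊕-homo = λ _ _ _ → refl ; ⊙-homo = λ _ _ _ → refl }

[m∸1]·_ : Family → Family
[m∸1]·_ = scaleBy (λ (m , _) → ℕ→ℚ (m ∸ 1))

[N]·_ : Family → Family
[N]·_ = scaleBy (λ (_ , N) → ℕ→ℚ N)

substS-oneS-*S : ∀ m (g : Series) → substS m oneS *S g ≐ g
substS-oneS-*S m g = ≐-trans (IsLinear.resp-≐ (*S-linearˡ g) (substS-oneS m)) (*S-identityˡ g)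

[m∸1]·-nestedSum-[] : [m∸1]· nestedSum [] ≐ consFam oneS (nestedSum [])
[m∸1]·-nestedSum-[] (m , N) =
  sym (trans (sumTo-≐ (m ∸ 1) (λ i → substS-oneS-*S i oneS N)) (sumTo-const (m ∸ 1) (oneS N)))

[m∸1]·-consFam : (E : Series) (F : Family) →
  [m∸1]· consFam E F ≐ consFam E F ⊕ consFam oneS (consFam E F) ⊕ consFam E ([m∸1]· F)
[m∸1]·-consFam E F (m , N) = begin
  ℕ→ℚ n * sumTo n a                                                     ≡⟨ ℕ→ℚ*sumTo n a ⟩
  sumTo n a + sumTo n (λ j → sumTo j a) + sumTo n (λ i → ℕ→ℚ i * a i)
    ≡⟨ cong₂ (λ x y → sumTo n a + x + y)
         (sumTo-≐ n (λ j → sym (substS-oneS-*S j (slice (consFam E F) (suc j)) N)))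
         (sumTo-≐ n (λ i → sym (IsLinear.⊙-homo (*S-linearʳ (substS i E)) (ℕ→ℚ i) (slice F (suc i)) N))) ⟩
  (consFam E F ⊕ consFam oneS (consFam E F) ⊕ consFam E ([m∸1]· F)) (m , N) ∎
  where
  n = m ∸ 1
  a : ℕ → ℚ
  a i = (substS i E *S slice F (suc i)) N

[N]·-nestedSum-[] : [N]· nestedSum [] ≐ 𝟘
[N]·-nestedSum-[] (m , zero)  = refl
[N]·-nestedSum-[] (m , suc N) = ℚP.*-zeroʳ (ℕ→ℚ (suc N))

-- Leibniz, and q d/dq E(q^{m₁}) = m₁ (qddq E)(q^{m₁}) with m₁ = 1 + (m₁ − 1).
[N]·-consFam : (E : Series) (F : Family) →
  [N]· consFam E F ≐ consFam (qddq E) (F ⊕ [m∸1]· F) ⊕ consFam E ([N]· F)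
[N]·-consFam E F (m , N) = begin
  ℕ→ℚ N * sumTo n (λ i → (substS i E *S slice F (suc i)) N)        ≡⟨ sumTo-⊙ n (ℕ→ℚ N) _ ⟨
  sumTo n (λ i → ℕ→ℚ N * (substS i E *S slice F (suc i)) N)        ≡⟨ sumTo-≐ n termwise ⟩
  sumTo n ((λ i → (substS i (qddq E) *S slice (F ⊕ [m∸1]· F) (suc i)) N)
         ⊕ (λ i → (substS i E *S slice ([N]· F) (suc i)) N))       ≡⟨ sumTo-⊕ n _ _ ⟩
  (consFam (qddq E) (F ⊕ [m∸1]· F) ⊕ consFam E ([N]· F)) (m , N)   ∎
  where
  n = m ∸ 1
  termwise : ∀ i → ℕ→ℚ N * (substS i E *S slice F (suc i)) N
               ≡ (substS i (qddq E) *S slice (F ⊕ [m∸1]· F) (suc i)) N + (substS i E *S slice ([N]· F) (suc i)) N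
  termwise i = begin
    ℕ→ℚ N * (substS i E *S Fᵢ) N                                  ≡⟨ qddq-*S (substS i E) Fᵢ N ⟩
    (qddq (substS i E) *S Fᵢ) N + (substS i E *S qddq Fᵢ) N       ≡⟨ cong (_+ (substS i E *S qddq Fᵢ) N) outer ⟩
    (substS i (qddq E) *S slice (F ⊕ [m∸1]· F) (suc i)) N + (substS i E *S qddq Fᵢ) N ∎
    where
    Fᵢ = slice F (suc i)
    E′ = substS i (qddq E)
    X = (E′ *S Fᵢ) N
    outer : (qddq (substS i E) *S Fᵢ) N ≡ (E′ *S slice (F ⊕ [m∸1]· F) (suc i)) N
    outer = begin
      (qddq (substS i E) *S Fᵢ) N           ≡⟨ IsLinear.resp-≐ (*S-linearˡ Fᵢ) (qddq-substS i E) N ⟩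
      ((ℕ→ℚ (suc i) ⊙ E′) *S Fᵢ) N          ≡⟨ IsLinear.⊙-homo (*S-linearˡ Fᵢ) (ℕ→ℚ (suc i)) E′ N ⟩
      ℕ→ℚ (suc i) * X                       ≡⟨ cong (_* X) (ℕ→ℚ-suc i) ⟩
      (1ℚ + ℕ→ℚ i) * X                      ≡⟨ solve 2 (λ k x → (con 1ℚ :+ k) :* x := x :+ k :* x) refl (ℕ→ℚ i) X ⟩
      X + ℕ→ℚ i * X                         ≡⟨ cong (X +_) (IsLinear.⊙-homo (*S-linearʳ E′) (ℕ→ℚ i) Fᵢ N) ⟨
      X + (E′ *S (ℕ→ℚ i ⊙ Fᵢ)) N            ≡⟨ IsLinear.⊕-homo (*S-linearʳ E′) Fᵢ (ℕ→ℚ i ⊙ Fᵢ) N ⟨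
      (E′ *S slice (F ⊕ [m∸1]· F) (suc i)) N ∎

-- The entries y^a/(1 − y)^k

shift : Series → Series
shift f zero    = 0ℚ
shift f (suc n) = f n

shift^ : ℕ → Series → Series
shift^ zero    f = f
shift^ (suc a) f = shift (shift^ a f)

shift-linear : IsLinear shift
shift-linear = record { resp-≐ = resp ; ⊕-homo = add ; ⊙-homo = scale }
  where
  resp : ∀ {f g} → f ≐ g → shift f ≐ shift g
  resp p zero    = refl
  resp p (suc n) = p n
  add : ∀ f g → shift (f ⊕ g) ≐ shift f ⊕ shift g
  add f g zero    = sym (ℚP.+-identityˡ 0ℚ)
  add f g (suc n) = refl
  scale : ∀ c f → shift (c ⊙ f) ≐ c ⊙ shift f
  scale c f zero    = sym (ℚP.*-zeroʳ c)
  scale c f (suc n) = refl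

shift^-linear : ∀ a → IsLinear (shift^ a)
shift^-linear zero    = record { resp-≐ = λ p → p ; ⊕-homo = λ _ _ → ≐-refl ; ⊙-homo = λ _ _ → ≐-refl }
shift^-linear (suc a) = ∘-linear shift-linear (shift^-linear a)

shift^-shift : ∀ a g → shift^ a (shift g) ≐ shift (shift^ a g)
shift^-shift zero    g = ≐-refl
shift^-shift (suc a) g = IsLinear.resp-≐ shift-linear (shift^-shift a g)

qddq-shift : ∀ f → qddq (shift f) ≐ shift f ⊕ shift (qddq f)
qddq-shift f zero    = ℚP.*-zeroʳ 0ℚ
qddq-shift f (suc n) = begin
  ℕ→ℚ (suc n) * f n        ≡⟨ cong (_* f n) (ℕ→ℚ-suc n) ⟩
  (1ℚ + ℕ→ℚ n) * f n       ≡⟨ ℚP.*-distribʳ-+ (f n) 1ℚ (ℕ→ℚ n) ⟩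
  1ℚ * f n + ℕ→ℚ n * f n   ≡⟨ cong (_+ ℕ→ℚ n * f n) (ℚP.*-identityˡ (f n)) ⟩
  f n + ℕ→ℚ n * f n        ∎

qddq-shift^ : ∀ a f → qddq (shift^ a f) ≐ ℕ→ℚ a ⊙ shift^ a f ⊕ shift^ a (qddq f)
qddq-shift^ zero    f n = sym (trans (cong (_+ qddq f n) (ℚP.*-zeroˡ (f n))) (ℚP.+-identityˡ (qddq f n)))
qddq-shift^ (suc a) f n = begin
  qddq (shift (shift^ a f)) n                   ≡⟨ qddq-shift (shift^ a f) n ⟩
  P + shift (qddq (shift^ a f)) n               ≡⟨ cong (P +_) (resp-≐ (qddq-shift^ a f) n) ⟩
  P + shift (ℕ→ℚ a ⊙ shift^ a f ⊕ shift^ a (qddq f)) n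
                                                ≡⟨ cong (P +_) (⊕-homo (ℕ→ℚ a ⊙ shift^ a f) _ n) ⟩
  P + (shift (ℕ→ℚ a ⊙ shift^ a f) n + Q)        ≡⟨ cong (λ x → P + (x + Q)) (⊙-homo (ℕ→ℚ a) (shift^ a f) n) ⟩
  P + (ℕ→ℚ a * P + Q)
    ≡⟨ solve 3 (λ p k q → p :+ (k :* p :+ q) := (con 1ℚ :+ k) :* p :+ q) refl P (ℕ→ℚ a) Q ⟩
  (1ℚ + ℕ→ℚ a) * P + Q                          ≡⟨ cong (λ x → x * P + Q) (ℕ→ℚ-suc a) ⟨
  ℕ→ℚ (suc a) * P + Q                           ∎
  where
  open IsLinear shift-linear
  P = shift (shift^ a f) n
  Q = shift (shift^ a (qddq f)) n

invPowS-0 : ∀ k → invPowS k 0 ≡ 1ℚ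
invPowS-0 zero    = refl
invPowS-0 (suc k) = trans (ℚP.+-identityˡ _) (trans (ℚP.*-identityˡ (invPowS k 0)) (invPowS-0 k))

invPowS-suc-suc : ∀ k n → invPowS (suc k) (suc n) ≡ invPowS k (suc n) + invPowS (suc k) n
invPowS-suc-suc k n = trans (sumTo-unfoldˡ (suc n) (λ i → 1ℚ * invPowS k (suc n ∸ i)))
                            (cong (_+ invPowS (suc k) n) (ℚP.*-identityˡ (invPowS k (suc n))))

invPowS-suc : ∀ k → invPowS (suc k) ≐ invPowS k ⊕ shift (invPowS (suc k))
invPowS-suc k zero    = trans (invPowS-0 (suc k)) (sym (trans (ℚP.+-identityʳ (invPowS k 0)) (invPowS-0 k)))
invPowS-suc k (suc n) = invPowS-suc-suc k n

-- The coefficient form of  y d/dy (1 − y)^{−k} = k y (1 − y)^{−k−1}.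
suc*invPowS-suc : ∀ k n → ℕ→ℚ (suc n) * invPowS k (suc n) ≡ ℕ→ℚ k * invPowS (suc k) n
suc*invPowS-suc zero    n = trans (ℚP.*-zeroʳ (ℕ→ℚ (suc n))) (sym (ℚP.*-zeroˡ (invPowS 1 n)))
suc*invPowS-suc (suc k) zero = begin
  ℕ→ℚ 1 * invPowS (suc k) 1
    ≡⟨ trans (ℚP.*-identityˡ _) (invPowS-suc-suc k 0) ⟩
  invPowS k 1 + invPowS (suc k) 0
    ≡⟨ cong₂ _+_ (trans (sym (ℚP.*-identityˡ (invPowS k 1))) (suc*invPowS-suc k 0)) (invPowS-0 (suc k)) ⟩
  ℕ→ℚ k * invPowS (suc k) 0 + 1ℚ
    ≡⟨ cong (λ x → ℕ→ℚ k * x + 1ℚ) (invPowS-0 (suc k)) ⟩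
  ℕ→ℚ k * 1ℚ + 1ℚ
    ≡⟨ solve 1 (λ k → k :* con 1ℚ :+ con 1ℚ := (con 1ℚ :+ k) :* con 1ℚ) refl (ℕ→ℚ k) ⟩
  (1ℚ + ℕ→ℚ k) * 1ℚ
    ≡⟨ cong₂ _*_ (ℕ→ℚ-suc k) (invPowS-0 (suc (suc k))) ⟨
  ℕ→ℚ (suc k) * invPowS (suc (suc k)) 0 ∎
suc*invPowS-suc (suc k) (suc n) = begin
  ℕ→ℚ (suc (suc n)) * invPowS (suc k) (suc (suc n))
    ≡⟨ cong₂ _*_ (ℕ→ℚ-suc (suc n)) (invPowS-suc-suc k (suc n)) ⟩
  (1ℚ + ℕ→ℚ (suc n)) * (X + A)
    ≡⟨ solve 3 (λ s x a → (con 1ℚ :+ s) :* (x :+ a) := (con 1ℚ :+ s) :* x :+ a :+ s :* a)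
               refl (ℕ→ℚ (suc n)) X A ⟩
  (1ℚ + ℕ→ℚ (suc n)) * X + A + ℕ→ℚ (suc n) * A
    ≡⟨ cong₂ (λ x y → x + A + y)
             (trans (cong (_* X) (sym (ℕ→ℚ-suc (suc n)))) (suc*invPowS-suc k (suc n)))
             (suc*invPowS-suc (suc k) n) ⟩
  ℕ→ℚ k * A + A + ℕ→ℚ (suc k) * B
    ≡⟨ cong (λ x → ℕ→ℚ k * A + A + x * B) (ℕ→ℚ-suc k) ⟩
  ℕ→ℚ k * A + A + (1ℚ + ℕ→ℚ k) * B
    ≡⟨ solve 3 (λ k a b → k :* a :+ a :+ (con 1ℚ :+ k) :* b := (con 1ℚ :+ k) :* (a :+ b))
               refl (ℕ→ℚ k) A B ⟩
  (1ℚ + ℕ→ℚ k) * (A + B)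
    ≡⟨ cong₂ _*_ (ℕ→ℚ-suc k) (invPowS-suc-suc (suc k) n) ⟨
  ℕ→ℚ (suc k) * invPowS (suc (suc k)) (suc n) ∎
  where
  X = invPowS k (suc (suc n))
  A = invPowS (suc k) (suc n)
  B = invPowS (suc (suc k)) n

qddq-invPowS : ∀ k → qddq (invPowS k) ≐ ℕ→ℚ k ⊙ shift (invPowS (suc k))
qddq-invPowS k zero    = trans (ℚP.*-zeroˡ (invPowS k 0)) (sym (ℚP.*-zeroʳ (ℕ→ℚ k)))
qddq-invPowS k (suc n) = suc*invPowS-suc k n

y^_/[1-y]^_ : ℕ → ℕ → Series
y^ a /[1-y]^ k = shift^ a (invPowS k)

y^/[1-y]^-cong : ∀ a {k k′} → k ≡ k′ → y^ a /[1-y]^ k ≐ y^ a /[1-y]^ k′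
y^/[1-y]^-cong a refl = ≐-refl

y^/[1-y]^-suc : ∀ a k → y^ a /[1-y]^ suc k ≐ y^ a /[1-y]^ k ⊕ y^ suc a /[1-y]^ suc k
y^/[1-y]^-suc a k = ≐-trans (resp-≐ (invPowS-suc k))
  (≐-trans (⊕-homo (invPowS k) (shift (invPowS (suc k))))
           (λ n → cong (shift^ a (invPowS k) n +_) (shift^-shift a (invPowS (suc k)) n)))
  where open IsLinear (shift^-linear a)

qddq-y^/[1-y]^ : ∀ a k →
  qddq (y^ a /[1-y]^ k) ≐ ℕ→ℚ a ⊙ y^ a /[1-y]^ k ⊕ ℕ→ℚ k ⊙ y^ suc a /[1-y]^ suc k
qddq-y^/[1-y]^ a k n = trans (qddq-shift^ a (invPowS k) n) (cong (ℕ→ℚ a * shift^ a (invPowS k) n +_) (begin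
  shift^ a (qddq (invPowS k)) n                   ≡⟨ resp-≐ (qddq-invPowS k) n ⟩
  shift^ a (ℕ→ℚ k ⊙ shift (invPowS (suc k))) n    ≡⟨ ⊙-homo (ℕ→ℚ k) (shift (invPowS (suc k))) n ⟩
  ℕ→ℚ k * shift^ a (shift (invPowS (suc k))) n    ≡⟨ cong (ℕ→ℚ k *_) (shift^-shift a (invPowS (suc k)) n) ⟩
  ℕ→ℚ k * (y^ suc a /[1-y]^ suc k) n              ∎))
  where open IsLinear (shift^-linear a)

polyS-[]-*S : (F : Series) → polyS [] *S F ≐ 𝟘
polyS-[]-*S F n = trans (sumTo-≐ (suc n) (λ i → ℚP.*-zeroˡ (F (n ∸ i)))) (sumTo-𝟘 (suc n))

polyS-∷-*S : ∀ c Q (F : Series) → polyS (c ∷ Q) *S F ≐ c ⊙ F ⊕ shift (polyS Q *S F)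
polyS-∷-*S c Q F zero    = trans (ℚP.+-identityˡ (c * F 0)) (sym (ℚP.+-identityʳ (c * F 0)))
polyS-∷-*S c Q F (suc n) = sumTo-unfoldˡ (suc n) (λ i → polyS (c ∷ Q) i * F (suc n ∸ i))

monomial-*S : ∀ a (F : Series) → polyS (replicate a 0ℚ ++ 1ℚ ∷ []) *S F ≐ shift^ a F
monomial-*S zero    F n = begin
  (polyS (1ℚ ∷ []) *S F) n               ≡⟨ polyS-∷-*S 1ℚ [] F n ⟩
  1ℚ * F n + shift (polyS [] *S F) n     ≡⟨ cong₂ _+_ (ℚP.*-identityˡ (F n)) (trans (resp-≐ (polyS-[]-*S F) n) (𝟘-homo n)) ⟩
  F n + 0ℚ                               ≡⟨ ℚP.+-identityʳ (F n) ⟩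
  F n                                    ∎
  where open IsLinear shift-linear
monomial-*S (suc a) F n = begin
  (polyS (0ℚ ∷ Q) *S F) n                ≡⟨ polyS-∷-*S 0ℚ Q F n ⟩
  0ℚ * F n + shift (polyS Q *S F) n      ≡⟨ cong₂ _+_ (ℚP.*-zeroˡ (F n)) (IsLinear.resp-≐ shift-linear (monomial-*S a F) n) ⟩
  0ℚ + shift^ (suc a) F n                ≡⟨ ℚP.+-identityˡ _ ⟩
  shift^ (suc a) F n                     ∎
  where Q = replicate a 0ℚ ++ 1ℚ ∷ []

entrySeries : Entry → Series
entrySeries (k , Q) = polyS Q *S invPowS k

tbzEntry : N̄ → Series
tbzEntry x = entrySeries (toEntry x)

N̄≢1 : Set
N̄≢1 = Σ N̄ λ k → ¬ k ≡ nat 0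

tbzEntry₁ : N̄≢1 → Series
tbzEntry₁ (x , _) = tbzEntry x

span₁⇒span : {f : Series} → Span tbzEntry₁ f → Span tbzEntry f
span₁⇒span = span-reindex proj₁ (λ _ → ≐-refl)

tbzEntry-nat : ∀ n → tbzEntry (nat n) ≐ y^ n /[1-y]^ suc n
tbzEntry-nat n = monomial-*S n (invPowS (suc n))

tbzEntry-bar1 : tbzEntry bar1 ≐ y^ 1 /[1-y]^ 1
tbzEntry-bar1 = monomial-*S 1 (invPowS 1)

y^/[1-y]^-span₁-offset : ∀ d a → Span tbzEntry₁ (y^ suc a /[1-y]^ (d ℕ.+ suc a))
y^/[1-y]^-span₁-offset zero          zero    = span-≐ (≐-sym tbzEntry-bar1) (span-gen (bar1 , λ ()))
y^/[1-y]^-span₁-offset zero          (suc a) = span-⊕-cancelˡ (y^/[1-y]^-suc (suc a) (suc a))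
  (span-≐ (≐-sym (tbzEntry-nat (suc a))) (span-gen (nat (suc a) , λ ())))
  (y^/[1-y]^-span₁-offset zero a)
y^/[1-y]^-span₁-offset (suc zero)    a       =
  span-≐ (≐-sym (tbzEntry-nat (suc a))) (span-gen (nat (suc a) , λ ()))
y^/[1-y]^-span₁-offset (suc (suc d)) a       = span-≐ (y^/[1-y]^-suc (suc a) (suc d ℕ.+ suc a))
  (span-⊕ (y^/[1-y]^-span₁-offset (suc d) a)
          (span-≐ (y^/[1-y]^-cong (suc (suc a)) (cong suc (sym (ℕP.+-suc d (suc a)))))
                  (y^/[1-y]^-span₁-offset (suc d) (suc a))))

y^/[1-y]^-span₁ : ∀ {a k} → 1 ≤ a → a ≤ k → Span tbzEntry₁ (y^ a /[1-y]^ k)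
y^/[1-y]^-span₁ {suc a} {k} _ a≤k =
  span-≐ (y^/[1-y]^-cong (suc a) (sym (ℕP.m∸n+n≡m a≤k))) (y^/[1-y]^-span₁-offset (k ∸ suc a) a)

y^/[1-y]^-span : ∀ {a k} → a ≤ k → Span tbzEntry (y^ a /[1-y]^ k)
y^/[1-y]^-span {zero}  {zero}  _   = span-⊕-cancelʳ (y^/[1-y]^-suc 0 0)
  (span-≐ (≐-sym (tbzEntry-nat 0)) (span-gen (nat 0)))
  (span-≐ (≐-sym tbzEntry-bar1) (span-gen bar1))
y^/[1-y]^-span {zero}  {suc k} _   = span-≐ (y^/[1-y]^-suc 0 k)
  (span-⊕ (y^/[1-y]^-span {0} {k} z≤n)
          (span₁⇒span (y^/[1-y]^-span₁ {1} {suc k} (s≤s z≤n) (s≤s z≤n))))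
y^/[1-y]^-span {suc a}         a≤k = span₁⇒span (y^/[1-y]^-span₁ (s≤s z≤n) a≤k)

-- For a = 0 the first term has coefficient 0, as it must: 1/(1 − y)^k is outside the span of tbzEntry₁.
qddq-y^/[1-y]^-span₁ : ∀ {a k} → a ≤ k → Span tbzEntry₁ (qddq (y^ a /[1-y]^ k))
qddq-y^/[1-y]^-span₁ {a} {k} a≤k = span-≐ (qddq-y^/[1-y]^ a k)
  (span-⊕ (firstTerm a a≤k) (span-⊙ (ℕ→ℚ k) (y^/[1-y]^-span₁ (s≤s z≤n) (s≤s a≤k))))
  where
  firstTerm : ∀ a → a ≤ k → Span tbzEntry₁ (ℕ→ℚ a ⊙ y^ a /[1-y]^ k)
  firstTerm zero    _   = span-≐ (λ n → ℚP.*-zeroˡ ((y^ 0 /[1-y]^ k) n)) span-𝟘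
  firstTerm (suc a) a≤k = span-⊙ (ℕ→ℚ (suc a)) (y^/[1-y]^-span₁ (s≤s z≤n) a≤k)

qddq-tbzEntry-span₁ : ∀ x → Span tbzEntry₁ (qddq (tbzEntry x))
qddq-tbzEntry-span₁ bar1    = span-≐ (IsLinear.resp-≐ qddq-linear tbzEntry-bar1)
                                     (qddq-y^/[1-y]^-span₁ {1} {1} (s≤s z≤n))
qddq-tbzEntry-span₁ (nat n) = span-≐ (IsLinear.resp-≐ qddq-linear (tbzEntry-nat n))
                                     (qddq-y^/[1-y]^-span₁ {n} {suc n} (ℕP.n≤1+n n))

shift^-polyS-span : {J : Set} {gen : J → Series} → ∀ k Q a →
  (∀ {b} → a ≤ b → b ≤ k → Span gen (y^ b /[1-y]^ k)) → length Q ℕ.+ a ≤ suc k →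
  Span gen (shift^ a (polyS Q *S invPowS k))
shift^-polyS-span k []      a spans _ =
  span-≐ (≐-trans (resp-≐ (polyS-[]-*S (invPowS k))) 𝟘-homo) span-𝟘
  where open IsLinear (shift^-linear a)
shift^-polyS-span k (c ∷ Q) a spans (s≤s le) = span-≐ split
  (span-⊕ (span-⊙ c (spans ℕP.≤-refl (ℕP.≤-trans (ℕP.m≤n+m a (length Q)) le)))
          (shift^-polyS-span k Q (suc a) (λ a<b → spans (ℕP.<⇒≤ a<b))
                              (ℕP.≤-trans (ℕP.≤-reflexive (ℕP.+-suc (length Q) a)) (s≤s le))))
  where
  open IsLinear (shift^-linear a)
  F = polyS Q *S invPowS k
  split : shift^ a (polyS (c ∷ Q) *S invPowS k) ≐ c ⊙ y^ a /[1-y]^ k ⊕ shift^ (suc a) F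
  split = ≐-trans (resp-≐ (polyS-∷-*S c Q (invPowS k)))
    (≐-trans (⊕-homo _ _) (λ n → cong₂ _+_ (⊙-homo c (invPowS k) n) (shift^-shift a F n)))

entrySeries-span : ∀ e → degOK e → Span tbzEntry (entrySeries e)
entrySeries-span (k , Q) le = shift^-polyS-span k Q 0 (λ _ → y^/[1-y]^-span)
  (ℕP.≤-trans (ℕP.≤-reflexive (ℕP.+-identityʳ (length Q))) le)

oneS-span : Span tbzEntry oneS
oneS-span = y^/[1-y]^-span {0} {0} z≤n

entrySeries-span₁ : ∀ k Q → degOK (k , Q) → noConst Q → Span tbzEntry₁ (entrySeries (k , Q))
entrySeries-span₁ k []      _  _   = span-≐ (polyS-[]-*S (invPowS k)) span-𝟘
entrySeries-span₁ k (c ∷ Q) le c≡0 = span-≐ dropConstant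
  (shift^-polyS-span k Q 1 y^/[1-y]^-span₁ (ℕP.≤-trans (ℕP.≤-reflexive (ℕP.+-comm (length Q) 1)) le))
  where
  F = polyS Q *S invPowS k
  dropConstant : entrySeries (k , c ∷ Q) ≐ shift F
  dropConstant n = begin
    (polyS (c ∷ Q) *S invPowS k) n       ≡⟨ polyS-∷-*S c Q (invPowS k) n ⟩
    c * invPowS k n + shift F n          ≡⟨ cong (λ x → x * invPowS k n + shift F n) c≡0 ⟩
    0ℚ * invPowS k n + shift F n         ≡⟨ cong (_+ shift F n) (ℚP.*-zeroˡ (invPowS k n)) ⟩
    0ℚ + shift F n                       ≡⟨ ℚP.+-identityˡ _ ⟩
    shift F n                            ∎

tbzFam : List N̄ → Family
tbzFam ks = nestedSum (map tbzEntry ks)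

tbzFam₁ : IndexTBZ → Family
tbzFam₁ (ks , _) = tbzFam ks

consFam-span : {I J : Set} {head : I → Series} {tail : J → Family} {E : Series} {F : Family} →
  Span head E → Span tail F → Span (λ (ij : I × J) → consFam (head (proj₁ ij)) (tail (proj₂ ij))) (consFam E F)
consFam-span = span-bilinear consFam consFam-linearˡ consFam-linearʳ

consFam-tbzFam-span : {E : Series} {F : Family} → Span tbzEntry E → Span tbzFam F → Span tbzFam (consFam E F)
consFam-tbzFam-span sE sF = span-reindex (λ (k , ks) → k ∷ ks) (λ _ → ≐-refl) (consFam-span sE sF)

consFam-tbzFam₁-span : {E : Series} {F : Family} → Span tbzEntry₁ E → Span tbzFam F → Span tbzFam₁ (consFam E F)
consFam-tbzFam₁-span sE sF = span-reindex (λ ((k , k≢1) , ks) → k ∷ ks , k≢1) (λ _ → ≐-refl) (consFam-span sE sF)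

[m∸1]·-tbzFam-span : ∀ ks → Span tbzFam ([m∸1]· tbzFam ks)
[m∸1]·-tbzFam-span []       = span-≐ [m∸1]·-nestedSum-[] (consFam-tbzFam-span oneS-span (span-gen []))
[m∸1]·-tbzFam-span (k ∷ ks) = span-≐ ([m∸1]·-consFam (tbzEntry k) (tbzFam ks))
  (span-⊕ (span-⊕ (span-gen (k ∷ ks)) (consFam-tbzFam-span oneS-span (span-gen (k ∷ ks))))
          (consFam-tbzFam-span (span-gen k) ([m∸1]·-tbzFam-span ks)))

mutual
  [N]·-consFam-span : {J : Set} {head : J → Series} {E : Series} →
    Span head E → Span head (qddq E) → ∀ ks →
    Span (λ (jks : J × List N̄) → consFam (head (proj₁ jks)) (tbzFam (proj₂ jks))) ([N]· consFam E (tbzFam ks))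
  [N]·-consFam-span {E = E} sE sqddqE ks = span-≐ ([N]·-consFam E (tbzFam ks))
    (span-⊕ (consFam-span sqddqE (span-⊕ (span-gen ks) ([m∸1]·-tbzFam-span ks)))
            (consFam-span sE ([N]·-tbzFam-span ks)))

  [N]·-tbzFam-span : ∀ ks → Span tbzFam ([N]· tbzFam ks)
  [N]·-tbzFam-span []       = span-≐ [N]·-nestedSum-[] span-𝟘
  [N]·-tbzFam-span (k ∷ ks) = span-reindex (λ (k , ks) → k ∷ ks) (λ _ → ≐-refl)
    ([N]·-consFam-span (span-gen k) (span₁⇒span (qddq-tbzEntry-span₁ k)) ks)

[N]·-tbzFam₁-span : ∀ ix → Span tbzFam₁ ([N]· tbzFam₁ ix)
[N]·-tbzFam₁-span ([]     , _)   = span-≐ [N]·-nestedSum-[] span-𝟘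
[N]·-tbzFam₁-span (k ∷ ks , k≢1) = span-reindex (λ ((k , k≢1) , ks) → k ∷ ks , k≢1) (λ _ → ≐-refl)
  ([N]·-consFam-span (span-gen (k , k≢1)) (qddq-tbzEntry-span₁ k) ks)

nestedSum-span : ∀ L → All degOK L → Span tbzFam (nestedSum (map entrySeries L))
nestedSum-span []      []       = span-gen []
nestedSum-span (e ∷ L) (d ∷ ds) = consFam-tbzFam-span (entrySeries-span e d) (nestedSum-span L ds)

nestedSum-span₁ : ∀ L → ValidZ L → Span tbzFam₁ (nestedSum (map entrySeries L))
nestedSum-span₁ []            _              = span-gen ([] , tt)
nestedSum-span₁ ((k , Q) ∷ L) (d ∷ ds , c≡0) =
  consFam-tbzFam₁-span (entrySeries-span₁ k Q d c≡0) (nestedSum-span L ds)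

-- ζ_q as a diagonal

G≐nestedSum : ∀ L m → G L m ≐ slice (nestedSum (map entrySeries L)) m
G≐nestedSum []            m N = refl
G≐nestedSum ((k , Q) ∷ L) m N = sumTo-≐ (m ∸ 1)
  (λ i → IsLinear.resp-≐ (*S-linearʳ (termS k Q i)) (G≐nestedSum L (suc i)) N)

ζq≐diagonal : ∀ L → ζq L ≐ diagonal (nestedSum (map entrySeries L))
ζq≐diagonal []      N = refl
ζq≐diagonal (e ∷ L) N = G≐nestedSum (e ∷ L) (suc N) N

genTBZ≐diagonal : ∀ ix → genTBZ ix ≐ diagonal (tbzFam₁ ix)
genTBZ≐diagonal (ks , _) N = trans (ζq≐diagonal (map toEntry ks) N)
  (cong (λ Es → nestedSum Es (suc N , N)) (sym (ListP.map-∘ ks)))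

diagonal-span : {F : Family} → Span tbzFam₁ F → Span genTBZ (diagonal F)
diagonal-span sF = span-reindex (λ ix → ix) (λ ix → ≐-sym (genTBZ≐diagonal ix)) (span-map diagonal-linear sF)

InSpan⇒Span : {I : Set} {gen : I → Series} {f : Series} → InSpan gen f → Span gen f
InSpan⇒Span {gen = gen} (cs , p) = cs , λ N → trans (p N) (lincomb≡linComb cs N)
  where
  lincomb≡linComb : ∀ cs N → lincomb gen cs N ≡ linComb gen cs N
  lincomb≡linComb []             N = refl
  lincomb≡linComb ((c , i) ∷ cs) N = cong (c * gen i N +_) (lincomb≡linComb cs N)

Span⇒InSpan : {I : Set} {gen : I → Series} {f : Series} → Span gen f → InSpan gen f
Span⇒InSpan {gen = gen} (cs , p) = cs , λ N → trans (p N) (linComb≡lincomb cs N)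
  where
  linComb≡lincomb : ∀ cs N → linComb gen cs N ≡ lincomb gen cs N
  linComb≡lincomb []             N = refl
  linComb≡lincomb ((c , i) ∷ cs) N = cong (c * gen i N +_) (linComb≡lincomb cs N)

toEntry-degOK : ∀ x → degOK (toEntry x)
toEntry-degOK bar1    = s≤s (s≤s z≤n)
toEntry-degOK (nat n) = ℕP.≤-trans (ℕP.≤-reflexive length≡) (ℕP.n≤1+n (suc n))
  where
  length≡ : length (replicate n 0ℚ ++ 1ℚ ∷ []) ≡ suc n
  length≡ = trans (ListP.length-++ (replicate n 0ℚ))
                  (trans (cong (ℕ._+ 1) (ListP.length-replicate n)) (ℕP.+-comm n 1))

toEntry-firstOK : ∀ ks → firstNot1 ks → firstOK (map toEntry ks)
toEntry-firstOK []                 _   = tt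
toEntry-firstOK (bar1 ∷ ks)        _   = refl
toEntry-firstOK (nat zero ∷ ks)    k≢1 = contradiction refl k≢1
toEntry-firstOK (nat (suc n) ∷ ks) _   = refl

tbzIndex⇒zIndex : IndexTBZ → IndexZ
tbzIndex⇒zIndex (ks , k≢1) = map toEntry ks , map⁺ (universal toEntry-degOK ks) , toEntry-firstOK ks k≢1

spanZ⊆spanTBZ : (f : Series) → InSpan genZ f → InSpan genTBZ f
spanZ⊆spanTBZ f = Span⇒InSpan ∘ span-trans ζq-span ∘ InSpan⇒Span
  where
  ζq-span : ∀ ix → Span genTBZ (genZ ix)
  ζq-span (L , valid) = span-≐ (ζq≐diagonal L) (diagonal-span (nestedSum-span₁ L valid))

spanTBZ⊆spanZ : (f : Series) → InSpan genTBZ f → InSpan genZ f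
spanTBZ⊆spanZ f = Span⇒InSpan ∘ span-reindex tbzIndex⇒zIndex (λ _ → ≐-refl) ∘ InSpan⇒Span

qddq-spanTBZ : (f : Series) → InSpan genTBZ f → InSpan genTBZ (qddq f)
qddq-spanTBZ f = Span⇒InSpan ∘ span-trans qddq-genTBZ-span ∘ span-map qddq-linear ∘ InSpan⇒Span
  where
  qddq-genTBZ-span : ∀ ix → Span genTBZ (qddq (genTBZ ix))
  qddq-genTBZ-span ix = span-≐ (IsLinear.resp-≐ qddq-linear (genTBZ≐diagonal ix))
                               (diagonal-span ([N]·-tbzFam₁-span ix))

proposition2p48 : ((f : Series) → InSpan genZ f ⇔ InSpan genTBZ f)
    × ((f : Series) → InSpan genTBZ f → InSpan genTBZ (qddq f))
proposition2p48 = (λ f → mk⇔ (spanZ⊆spanTBZ f) (spanTBZ⊆spanZ f)) , qddq-spanTBZ
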